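{- Let $n\ge 11$ and $T_{n,n-5}=\frac{n(n+1)}{2}-(n-5)$. Then $\#\mathbb U^*_{T_{n,n-5}}=2$.
   Context: A partition of $N$ into distinct parts is a sequence of positive integers $\lambda_1<\dots<\lambda_t$ summing to $N$ with $t\ge 2$. Its missing parts are the elements of $\{1,\dots,\lambda_t\}\setminus\{\lambda_1,\dots,\lambda_t\}$. $\lambda$ is refinable if two distinct missing parts sum to a part of $\lambda$, unrefinable otherwise; $\mathbb U_N$ is the set of unrefinable partitions of $N$. $\mathbb U^*_N$ is the set of $\lambda\in\mathbb U_N$ whose largest part is the maximum of the largest parts over all of $\mathbb U_N$. Standing assumption: $n\ge 11$. -}

module Defs where

open import Data.Nat using (ℕ; _+_; _*_; _∸_; _≤_; _<_; _⊔_)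
open import Data.Nat.DivMod using (_/_)
open import Data.List using (List; length; foldr)
open import Data.Nat.ListAction using (sum)
open import Data.List.Relation.Unary.All using (All)
open import Data.List.Relation.Unary.Linked using (Linked)
open import Data.List.Membership.Propositional using (_∈_; _∉_)
open import Data.Product using (_×_; ∃₂)
open import Relation.Binary.PropositionalEquality using (_≡_; _≢_)
open import Relation.Nullary using (¬_)

-- A partition into distinct parts is represented by the strictly increasing
-- list of its parts  λ₁ < ⋯ < λₜ .

largestPart : List ℕ → ℕ
largestPart = foldr _⊔_ 0

DistinctPartition : ℕ → List ℕ → Set
DistinctPartition N λs =
  Linked _<_ λs × All (λ x → 1 ≤ x) λs × 2 ≤ length λs × sum λs ≡ N

Missing : List ℕ → ℕ → Set
Missing λs m = 1 ≤ m × m ≤ largestPart λs × m ∉ λs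

Refinable : List ℕ → Set
Refinable λs = ∃₂ λ a b → a ≢ b × Missing λs a × Missing λs b × (a + b) ∈ λs

Unrefinable : List ℕ → Set
Unrefinable λs = ¬ Refinable λs

InU : ℕ → List ℕ → Set
InU N λs = DistinctPartition N λs × Unrefinable λs

InUStar : ℕ → List ℕ → Set
InUStar N λs = InU N λs × (∀ μ → InU N μ → largestPart μ ≤ largestPart λs)

T : ℕ → ℕ
T n = (n * (n + 1)) / 2 ∸ (n ∸ 5)

{-# OPTIONS --safe #-}

-- In an unrefinable partition with largest part L, every pair {a, L − a} with 2a < L contains a
-- part: otherwise the two missing numbers would refine L. Summing over the pairs gives
-- N ≥ (1 + ⋯ + ⌊(L − 1)/2⌋) + L, which for N = T_{n,n−5} forces L ≤ 2n − 4, a value attained by two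
-- explicit partitions. When L = 2n − 4 this bound has slack exactly 6, the middle number n − 2 is
-- missing, and from each pair only one member is a part; taking the larger member costs L − 2a,
-- which is affordable only for a = n − 5, n − 4, n − 3, at costs 6, 4, 2. The chosen costs must add
-- up to 6, and the two ways to do so, 6 and 4 + 2, determine all parts.
module Submission where

open import Defs
open import Data.Nat using (ℕ; _≤_)
open import Data.List using (List)
open import Data.Product using (_×_; ∃₂)
open import Data.Sum using (_⊎_)
open import Relation.Binary.PropositionalEquality using (_≡_; _≢_)

open import Data.Empty using (⊥; ⊥-elim)
open import Data.List.Base using ([]; _∷_; _++_; [_]; applyUpTo; length)
open import Data.List.Membership.Propositional using (_∈_; _∉_)
open import Data.List.Membership.Propositional.Properties
  using (∈-applyUpTo⁺; ∈-applyUpTo⁻; ∈-++⁺ˡ; ∈-++⁺ʳ; ∈-++⁻; foldr-selective)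
open import Data.List.Membership.Propositional.Properties.WithK using (unique∧set⇒bag)
open import Data.List.Properties using (applyUpTo-∷ʳ; length-++; foldr-forcesᵇ; foldr-preservesᵇ)
open import Data.List.Relation.Binary.BagAndSetEquality using (∼bag⇒↭)
open import Data.List.Relation.Binary.Permutation.Propositional using (↭⇒↭ₛ)
open import Data.List.Relation.Binary.Pointwise using (Pointwise-≡⇒≡)
open import Data.List.Relation.Unary.All as All using (All; []; _∷_)
open import Data.List.Relation.Unary.All.Properties as All using (All¬⇒¬Any)
open import Data.List.Relation.Unary.AllPairs as AllPairs using (AllPairs; []; _∷_)
import Data.List.Relation.Unary.AllPairs.Properties as AllPairs
open import Data.List.Relation.Unary.Any using (here; there)
open import Data.List.Relation.Unary.Linked as Linked using (Linked)
open import Data.List.Relation.Unary.Linked.Properties using (AllPairs⇒Linked; Linked⇒AllPairs)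
open import Data.List.Relation.Unary.Sorted.TotalOrder.Properties using (↗↭↗⇒≋)
open import Data.List.Relation.Unary.Unique.Propositional using (Unique)
open import Data.Nat.Base
open import Data.Nat.DivMod using (m*n/n≡m)
open import Data.Nat.ListAction using (sum)
open import Data.Nat.ListAction.Properties using (sum-++)
open import Data.Nat.Properties
open import Data.Nat.Tactic.RingSolver using (solve-∀)
open import Data.List.Membership.DecPropositional _≟_ using (_∈?_)
open import Data.Product using (_,_; proj₁; proj₂; ∃; uncurry)
open import Data.Sum using (inj₁; inj₂; [_,_]′)
open import Function.Base using (_∘_; id)
open import Function.Bundles using (_⇔_; mk⇔; Equivalence)
open import Function.Properties.Equivalence using () renaming (sym to ⇔-sym)
open import Relation.Binary.Definitions using (Tri; tri<; tri≈; tri>)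
open import Relation.Binary.PropositionalEquality
  using (refl; sym; trans; cong; cong₂; subst; module ≡-Reasoning)
open import Relation.Nullary using (Dec; yes; no; contradiction)

∑ : ℕ → (ℕ → ℕ) → ℕ
∑ zero    f = 0
∑ (suc k) f = ∑ k f + f (suc k)

triangular : ℕ → ℕ
triangular k = ∑ k id

∑-cong : ∀ {f g} k → (∀ a → 1 ≤ a → a ≤ k → f a ≡ g a) → ∑ k f ≡ ∑ k g
∑-cong zero    _   = refl
∑-cong (suc k) f≡g =
  cong₂ _+_ (∑-cong k (λ a 1≤a a≤k → f≡g a 1≤a (m≤n⇒m≤1+n a≤k))) (f≡g (suc k) (s≤s z≤n) ≤-refl)

∑-mono-≤ : ∀ {f g} k → (∀ a → 1 ≤ a → a ≤ k → f a ≤ g a) → ∑ k f ≤ ∑ k g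
∑-mono-≤ zero    _   = z≤n
∑-mono-≤ (suc k) f≤g =
  +-mono-≤ (∑-mono-≤ k (λ a 1≤a a≤k → f≤g a 1≤a (m≤n⇒m≤1+n a≤k))) (f≤g (suc k) (s≤s z≤n) ≤-refl)

∑-slack : ∀ {f g} k c → (∀ a → 1 ≤ a → a ≤ k → g a ≤ f a) → ∑ k f ≤ ∑ k g + c →
          ∀ a → 1 ≤ a → a ≤ k → f a ≤ g a + c
∑-slack zero    c g≤f Σf≤ a (s≤s _) ()
∑-slack {f} {g} (suc k) c g≤f Σf≤ a 1≤a a≤1+k with m≤n⇒m<n∨m≡n a≤1+k
... | inj₁ a<1+k = ∑-slack k c g≤f′ Σf≤′ a 1≤a (≤-pred a<1+k)
  where
  g≤f′ : ∀ b → 1 ≤ b → b ≤ k → g b ≤ f b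
  g≤f′ b 1≤b b≤k = g≤f b 1≤b (m≤n⇒m≤1+n b≤k)
  Σf≤′ : ∑ k f ≤ ∑ k g + c
  Σf≤′ = +-cancelʳ-≤ (g (suc k)) _ _ (begin
    ∑ k f + g (suc k)     ≤⟨ +-monoʳ-≤ (∑ k f) (g≤f (suc k) (s≤s z≤n) ≤-refl) ⟩
    ∑ k f + f (suc k)     ≤⟨ Σf≤ ⟩
    ∑ k g + g (suc k) + c ≡⟨ +-assoc (∑ k g) _ c ⟩
    ∑ k g + (g (suc k) + c) ≡⟨ cong (∑ k g +_) (+-comm (g (suc k)) c) ⟩
    ∑ k g + (c + g (suc k)) ≡⟨ +-assoc (∑ k g) c _ ⟨
    ∑ k g + c + g (suc k) ∎)
    where open ≤-Reasoning
... | inj₂ refl = +-cancelˡ-≤ (∑ k g) _ _ (begin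
    ∑ k g + f (suc k)     ≤⟨ +-monoˡ-≤ (f (suc k)) (∑-mono-≤ k (λ b 1≤b b≤k → g≤f b 1≤b (m≤n⇒m≤1+n b≤k))) ⟩
    ∑ k f + f (suc k)     ≤⟨ Σf≤ ⟩
    ∑ k g + g (suc k) + c ≡⟨ +-assoc (∑ k g) _ c ⟩
    ∑ k g + (g (suc k) + c) ∎)
  where open ≤-Reasoning

∑-update : ∀ {f g} K {x} c → 1 ≤ x → x ≤ K → (∀ v → v ≢ x → f v ≡ g v) → f x ≡ g x + c →
           ∑ K f ≡ ∑ K g + c
∑-update zero    c (s≤s _) ()
∑-update {f} {g} (suc K) {x} c 1≤x x≤1+K f≡g fx≡ with m≤n⇒m<n∨m≡n x≤1+K
... | inj₁ x<1+K = begin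
    ∑ K f + f (suc K)     ≡⟨ cong₂ _+_ (∑-update K c 1≤x (≤-pred x<1+K) f≡g fx≡) (f≡g (suc K) (>⇒≢ x<1+K)) ⟩
    ∑ K g + c + g (suc K) ≡⟨ +-assoc (∑ K g) c _ ⟩
    ∑ K g + (c + g (suc K)) ≡⟨ cong (∑ K g +_) (+-comm c _) ⟩
    ∑ K g + (g (suc K) + c) ≡⟨ +-assoc (∑ K g) _ c ⟨
    ∑ K g + g (suc K) + c ∎
  where open ≡-Reasoning
... | inj₂ refl = begin
    ∑ K f + f (suc K)     ≡⟨ cong₂ _+_ (∑-cong K (λ v _ v≤K → f≡g v (<⇒≢ (s≤s v≤K)))) fx≡ ⟩
    ∑ K g + (g (suc K) + c) ≡⟨ +-assoc (∑ K g) _ c ⟨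
    ∑ K g + g (suc K) + c ∎
  where open ≡-Reasoning

∑-suc : ∀ r f → ∑ (suc r) f ≡ f 1 + ∑ r (f ∘ suc)
∑-suc zero    f = +-comm 0 (f 1)
∑-suc (suc r) f = begin
  ∑ (suc r) f + f (2 + r)         ≡⟨ cong (_+ f (2 + r)) (∑-suc r f) ⟩
  f 1 + ∑ r (f ∘ suc) + f (2 + r) ≡⟨ +-assoc (f 1) _ _ ⟩
  f 1 + ∑ (suc r) (f ∘ suc)       ∎
  where open ≡-Reasoning

∑-fold : ∀ f k r {N} → N ≡ suc (k + k + r) →
         ∑ (k + k + r) f ≡ ∑ k (λ a → f a + f (N ∸ a)) + ∑ r (λ i → f (k + i))
∑-fold f zero    r _ = refl
∑-fold f (suc k) r {N} refl = begin
  ∑ (suc k + suc k + r) f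
    ≡⟨ cong (λ m → ∑ m f) (twoMore k r) ⟩
  ∑ (k + k + suc (suc r)) f
    ≡⟨ ∑-fold f k (suc (suc r)) (cong suc (twoMore k r)) ⟩
  P + (∑ (suc r) g + g (2 + r))
    ≡⟨ cong (λ s → P + (s + g (2 + r))) (∑-suc r g) ⟩
  P + (g 1 + ∑ r (g ∘ suc) + g (2 + r))
    ≡⟨ regroup P (g 1) _ (g (2 + r)) ⟩
  P + (g 1 + g (2 + r)) + ∑ r (g ∘ suc)
    ≡⟨ cong₂ (λ i j → P + (f i + f j) + ∑ r (g ∘ suc)) (+-comm k 1) (sym outer) ⟩
  P + (f (suc k) + f (N ∸ suc k)) + ∑ r (g ∘ suc)
    ≡⟨ cong (P + (f (suc k) + f (N ∸ suc k)) +_) (∑-cong r (λ i _ _ → cong f (+-suc k i))) ⟩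
  ∑ (suc k) (λ a → f a + f (N ∸ a)) + ∑ r (λ i → f (suc k + i)) ∎
  where
  open ≡-Reasoning
  P = ∑ k (λ a → f a + f (N ∸ a))
  g = λ i → f (k + i)
  twoMore : ∀ k r → suc k + suc k + r ≡ k + k + suc (suc r)
  twoMore = solve-∀
  regroup : ∀ p x s y → p + (x + s + y) ≡ p + (x + y) + s
  regroup = solve-∀
  outer : N ∸ suc k ≡ k + suc (suc r)
  outer = trans (cong (_∸ suc k) (shape k r)) (m+n∸m≡n (suc k) _)
    where
    shape : ∀ k r → suc (suc k + suc k + r) ≡ suc k + (k + suc (suc r))
    shape = solve-∀

triangular-closed : ∀ n → n * (n + 1) / 2 ≡ triangular n
triangular-closed n = trans (cong (_/ 2) (sym (double n))) (m*n/n≡m (triangular n) 2)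
  where
  double : ∀ n → triangular n * 2 ≡ n * (n + 1)
  double zero    = refl
  double (suc n) = begin
    (triangular n + suc n) * 2      ≡⟨ *-distribʳ-+ 2 (triangular n) (suc n) ⟩
    triangular n * 2 + suc n * 2    ≡⟨ cong (_+ suc n * 2) (double n) ⟩
    n * (n + 1) + suc n * 2         ≡⟨ step n ⟩
    suc n * (suc n + 1)             ∎
    where
    open ≡-Reasoning
    step : ∀ n → n * (n + 1) + suc n * 2 ≡ suc n * (suc n + 1)
    step = solve-∀

weight : List ℕ → ℕ → ℕ
weight μ v with v ∈? μ
... | yes _ = v
... | no  _ = 0

module _ {μ : List ℕ} {v : ℕ} where

  weight-∈ : v ∈ μ → weight μ v ≡ v
  weight-∈ v∈μ with v ∈? μ
  ... | yes _   = refl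
  ... | no  v∉μ = contradiction v∈μ v∉μ

  weight-∉ : v ∉ μ → weight μ v ≡ 0
  weight-∉ v∉μ with v ∈? μ
  ... | yes v∈μ = contradiction v∈μ v∉μ
  ... | no  _   = refl

weight-∷-≢ : ∀ {x μ v} → v ≢ x → weight (x ∷ μ) v ≡ weight μ v
weight-∷-≢ {x} {μ} {v} v≢x = by-cases (v ∈? μ)
  where
  by-cases : Dec (v ∈ μ) → weight (x ∷ μ) v ≡ weight μ v
  by-cases (yes v∈μ) = trans (weight-∈ {x ∷ μ} (there v∈μ)) (sym (weight-∈ v∈μ))
  by-cases (no  v∉μ) = trans (weight-∉ {x ∷ μ} λ { (here v≡x) → v≢x v≡x ; (there v∈μ) → v∉μ v∈μ })
                             (sym (weight-∉ v∉μ))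

sum≡∑weight : ∀ {μ K} → Unique μ → All (1 ≤_) μ → All (_≤ K) μ → sum μ ≡ ∑ K (weight μ)
sum≡∑weight {[]}    {K} [] [] [] = sym (trans (∑-cong K (λ v _ _ → weight-∉ {[]} {v} λ ())) (zeros K))
  where
  zeros : ∀ K → ∑ K (λ _ → 0) ≡ 0
  zeros zero    = refl
  zeros (suc K) = cong (_+ 0) (zeros K)
sum≡∑weight {x ∷ μ} {K} (x∉ ∷ μ!) (1≤x ∷ 1≤μ) (x≤K ∷ μ≤K) = begin
  x + sum μ          ≡⟨ +-comm x _ ⟩
  sum μ + x          ≡⟨ cong (_+ x) (sum≡∑weight μ! 1≤μ μ≤K) ⟩
  ∑ K (weight μ) + x ≡⟨ ∑-update K x 1≤x x≤K (λ v → weight-∷-≢) x-added ⟨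
  ∑ K (weight (x ∷ μ)) ∎
  where
  open ≡-Reasoning
  x-added : weight (x ∷ μ) x ≡ weight μ x + x
  x-added = trans (weight-∈ {x ∷ μ} (here refl)) (sym (cong (_+ x) (weight-∉ (All¬⇒¬Any x∉))))

parts≤largestPart : ∀ μ → All (_≤ largestPart μ) μ
parts≤largestPart μ =
  foldr-forcesᵇ (λ x y x⊔y≤ → m⊔n≤o⇒m≤o x y x⊔y≤ , m⊔n≤o⇒n≤o x y x⊔y≤) 0 μ ≤-refl

largestPart-≡ : ∀ {m μ} → m ∈ μ → All (_≤ m) μ → largestPart μ ≡ m
largestPart-≡ {μ = μ} m∈μ μ≤m =
  ≤-antisym (foldr-preservesᵇ ⊔-lub z≤n μ≤m) (All.lookup (parts≤largestPart μ) m∈μ)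

distinct⇒unique : ∀ {N μ} → DistinctPartition N μ → Unique μ
distinct⇒unique (μ↗ , _) = AllPairs.map <⇒≢ (Linked⇒AllPairs <-trans μ↗)

largestPart-∈ : ∀ {N μ} → DistinctPartition N μ → largestPart μ ∈ μ
largestPart-∈ {μ = []}    (_ , _ , () , _)
largestPart-∈ {μ = x ∷ μ} (_ , 1≤x ∷ _ , _ , _) with foldr-selective ⊔-sel 0 (x ∷ μ)
... | inj₁ L≡0 = contradiction (≤-trans 1≤x (subst (x ≤_) L≡0 (m≤m⊔n x (largestPart μ)))) λ ()
... | inj₂ L∈μ = L∈μ

unrefinable-complement : ∀ {μ p a b} → Unrefinable μ → p ∈ μ → a + b ≡ p → a ≢ b →
                         1 ≤ a → 1 ≤ b → a ∈ μ ⊎ b ∈ μ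
unrefinable-complement {μ} {p} {a} {b} unref p∈μ a+b≡p a≢b 1≤a 1≤b with a ∈? μ | b ∈? μ
... | yes a∈μ | _       = inj₁ a∈μ
... | no  _   | yes b∈μ = inj₂ b∈μ
... | no  a∉μ | no  b∉μ =
  ⊥-elim (unref (a , b , a≢b , (1≤a , below (m≤m+n a b) , a∉μ) , (1≤b , below (m≤n+m b a) , b∉μ) ,
                 subst (_∈ μ) (sym a+b≡p) p∈μ))
  where
  below : ∀ {v} → v ≤ a + b → v ≤ largestPart μ
  below v≤a+b = ≤-trans v≤a+b (≤-trans (≤-reflexive a+b≡p) (All.lookup (parts≤largestPart μ) p∈μ))

pairWeight : List ℕ → ℕ → ℕ → ℕ
pairWeight μ p a = weight μ a + weight μ (p ∸ a)

pairWeight-≥ : ∀ {μ p a} → Unrefinable μ → p ∈ μ → 1 ≤ a → a + a < p → a ≤ pairWeight μ p a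
pairWeight-≥ {μ} {p} {a} unref p∈μ 1≤a a+a<p =
  [ (λ a∈μ → subst (λ w → a ≤ w + weight μ (p ∸ a)) (sym (weight-∈ a∈μ)) (m≤m+n a _))
  , (λ b∈μ → ≤-trans (<⇒≤ a<p∸a) (subst (λ w → p ∸ a ≤ weight μ a + w) (sym (weight-∈ b∈μ)) (m≤n+m _ _)))
  ]′ (unrefinable-complement unref p∈μ (m+[n∸m]≡n a≤p) (<⇒≢ a<p∸a) 1≤a (≤-trans 1≤a (<⇒≤ a<p∸a)))
  where
  a≤p : a ≤ p
  a≤p = ≤-trans (m≤m+n a a) (<⇒≤ a+a<p)
  a<p∸a : a < p ∸ a
  a<p∸a = m+n≤o⇒m≤o∸n (suc a) a+a<p

sum-paired : ∀ {μ p} k r → Unique μ → All (1 ≤_) μ → All (_≤ p) μ → p ∈ μ → p ≡ suc (k + k + r) →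
             sum μ ≡ ∑ k (pairWeight μ p) + ∑ r (λ i → weight μ (k + i)) + p
sum-paired {μ} k r μ! 1≤μ μ≤p p∈μ refl = begin
  sum μ                                                ≡⟨ sum≡∑weight μ! 1≤μ μ≤p ⟩
  ∑ (k + k + r) (weight μ) + weight μ (suc (k + k + r)) ≡⟨ cong₂ _+_ (∑-fold (weight μ) k r refl) (weight-∈ p∈μ) ⟩
  ∑ k (pairWeight μ _) + ∑ r (λ i → weight μ (k + i)) + suc (k + k + r) ∎
  where open ≡-Reasoning

triangular+largestPart≤ : ∀ {N μ} k → InU N μ → k + k < largestPart μ → triangular k + largestPart μ ≤ N
triangular+largestPart≤ {N} {μ} k (μ∈D@(_ , 1≤μ , _ , sum≡N) , unref) k+k<L = begin
  triangular k + L
    ≤⟨ +-monoˡ-≤ L (∑-mono-≤ k λ a 1≤a a≤k →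
         pairWeight-≥ unref L∈μ 1≤a (≤-<-trans (+-mono-≤ a≤k a≤k) k+k<L)) ⟩
  ∑ k (pairWeight μ L) + L
    ≤⟨ +-monoˡ-≤ L (m≤m+n _ _) ⟩
  ∑ k (pairWeight μ L) + ∑ r (λ i → weight μ (k + i)) + L
    ≡⟨ sum-paired k r (distinct⇒unique μ∈D) 1≤μ (parts≤largestPart μ) L∈μ L≡ ⟨
  sum μ
    ≡⟨ sum≡N ⟩
  N ∎
  where
  open ≤-Reasoning
  L = largestPart μ
  r = L ∸ suc (k + k)
  L∈μ : L ∈ μ
  L∈μ = largestPart-∈ μ∈D
  L≡ : L ≡ suc (k + k + r)
  L≡ = sym (m+[n∸m]≡n k+k<L)

strictlySorted-≡ : ∀ {μ ν : List ℕ} → Linked _<_ μ → Linked _<_ ν → (∀ {v} → v ∈ μ ⇔ v ∈ ν) → μ ≡ ν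
strictlySorted-≡ μ↗ ν↗ μ⇔ν =
  Pointwise-≡⇒≡ (↗↭↗⇒≋ ≤-totalOrder (Linked.map <⇒≤ μ↗) (Linked.map <⇒≤ ν↗)
    (↭⇒↭ₛ (∼bag⇒↭ (unique∧set⇒bag (unique μ↗) (unique ν↗) μ⇔ν))))
  where
  unique : ∀ {ξ} → Linked _<_ ξ → Unique ξ
  unique ξ↗ = AllPairs.map <⇒≢ (Linked⇒AllPairs <-trans ξ↗)

unrefinable-criterion : ∀ {μ} m → (∀ {a} → 1 ≤ a → a ≤ m → a ∈ μ) →
                        (∀ {a b} → m < a → a < b → a + b ∈ μ → a ∈ μ ⊎ b ∈ μ) → Unrefinable μ
unrefinable-criterion {μ} m initial pairs (a , b , a≢b , (1≤a , _ , a∉μ) , (1≤b , _ , b∉μ) , a+b∈μ) =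
  by-order (<-cmp a b)
  where
  above : ∀ {v} → 1 ≤ v → v ∉ μ → m < v
  above 1≤v v∉μ = ≰⇒> (v∉μ ∘ initial 1≤v)
  by-order : Tri (a < b) (a ≡ b) (b < a) → ⊥
  by-order (tri< a<b _ _) = [ a∉μ , b∉μ ]′ (pairs (above 1≤a a∉μ) a<b a+b∈μ)
  by-order (tri≈ _ a≡b _) = a≢b a≡b
  by-order (tri> _ _ b<a) = [ b∉μ , a∉μ ]′ (pairs (above 1≤b b∉μ) b<a (subst (_∈ μ) (+-comm a b) a+b∈μ))

oneTo : ℕ → List ℕ
oneTo = applyUpTo suc

∈-oneTo⁺ : ∀ {m v} → 1 ≤ v → v ≤ m → v ∈ oneTo m
∈-oneTo⁺ {v = suc i} (s≤s z≤n) i<m = ∈-applyUpTo⁺ suc i<m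

∈-oneTo⁻ : ∀ {m v} → v ∈ oneTo m → 1 ≤ v × v ≤ m
∈-oneTo⁻ v∈ with _ , i<m , refl ← ∈-applyUpTo⁻ suc v∈ = s≤s z≤n , i<m

sum-oneTo : ∀ m → sum (oneTo m) ≡ triangular m
sum-oneTo zero    = refl
sum-oneTo (suc m) = begin
  sum (oneTo (suc m))           ≡⟨ cong sum (applyUpTo-∷ʳ suc m) ⟨
  sum (oneTo m ++ [ suc m ])    ≡⟨ sum-++ (oneTo m) [ suc m ] ⟩
  sum (oneTo m) + (suc m + 0)   ≡⟨ cong₂ _+_ (sum-oneTo m) (+-identityʳ (suc m)) ⟩
  triangular m + suc m          ∎
  where open ≡-Reasoning

oneTo++-distinct : ∀ {m tl} → AllPairs _<_ tl → All (m <_) tl → 2 ≤ length tl →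
                   DistinctPartition (triangular m + sum tl) (oneTo m ++ tl)
oneTo++-distinct {m} {tl} tl↗ m<tl 2≤|tl| =
    AllPairs⇒Linked (AllPairs.++⁺ (AllPairs.applyUpTo⁺₁ suc m λ i<j _ → s≤s i<j) tl↗
                                  (All.tabulate λ v∈ → All.map (≤-<-trans (proj₂ (∈-oneTo⁻ v∈))) m<tl))
  , All.++⁺ (All.tabulate (proj₁ ∘ ∈-oneTo⁻)) (All.map (≤-trans (s≤s z≤n)) m<tl)
  , ≤-trans 2≤|tl| (subst (length tl ≤_) (sym (length-++ (oneTo m))) (m≤n+m _ _))
  , trans (sum-++ (oneTo m) tl) (cong (_+ sum tl) (sum-oneTo m))

data OnlyOne (μ : List ℕ) (a b : ℕ) : ℕ → Set where
  only-left  : a ∈ μ → b ∉ μ → OnlyOne μ a b a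
  only-right : a ∉ μ → b ∈ μ → OnlyOne μ a b b

onlyOne-weight : ∀ {μ a b w} → OnlyOne μ a b w → weight μ a + weight μ b ≡ w
onlyOne-weight {μ} {a} {b} (only-left a∈μ b∉μ) =
  trans (cong₂ _+_ (weight-∈ {μ} a∈μ) (weight-∉ {μ} {b} b∉μ)) (+-identityʳ a)
onlyOne-weight {μ} {a} (only-right a∉μ b∈μ) = cong₂ _+_ (weight-∉ {μ} {a} a∉μ) (weight-∈ {μ} b∈μ)

between : ∀ {c a} → c ≤ a → a ≤ 2 + c → a ≡ c ⊎ a ≡ 1 + c ⊎ a ≡ 2 + c
between c≤a a≤2+c with m≤n⇒m<n∨m≡n a≤2+c
... | inj₂ a≡2+c = inj₂ (inj₂ a≡2+c)
... | inj₁ a<2+c with m≤n⇒m<n∨m≡n (≤-pred a<2+c)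
...   | inj₂ a≡1+c = inj₂ (inj₁ a≡1+c)
...   | inj₁ a<1+c = inj₁ (≤-antisym (≤-pred a<1+c) c≤a)

-- Throughout, n = 11 + t, and maxLargest t = 2n − 4 is the largest part of the elements of 𝕌*.
maxLargest : ℕ → ℕ
maxLargest t = 18 + (t + t)

T-value : ∀ t → T (11 + t) ≡ triangular (8 + t) + 6 + maxLargest t
T-value t = begin
  (11 + t) * (11 + t + 1) / 2 ∸ (6 + t)                 ≡⟨ cong (_∸ (6 + t)) (triangular-closed (11 + t)) ⟩
  triangular (11 + t) ∸ (6 + t)                         ≡⟨ cong (_∸ (6 + t)) (regroup (triangular (8 + t)) t) ⟩
  (6 + t) + (triangular (8 + t) + 6 + maxLargest t) ∸ (6 + t) ≡⟨ m+n∸m≡n (6 + t) _ ⟩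
  triangular (8 + t) + 6 + maxLargest t                 ∎
  where
  open ≡-Reasoning
  regroup : ∀ X t → X + (9 + t) + (10 + t) + (11 + t) ≡ (6 + t) + (X + 6 + (18 + (t + t)))
  regroup = solve-∀

maxLargest-∸ : ∀ c e t → (c + e) + (t + t) ∸ (c + t) ≡ e + t
maxLargest-∸ c e t = trans (cong (_∸ (c + t)) (regroup c e t)) (m+n∸m≡n (c + t) (e + t))
  where
  regroup : ∀ c e t → (c + e) + (t + t) ≡ (c + t) + (e + t)
  regroup = solve-∀

c+t≤c+e+[t+t] : ∀ c e t → c + t ≤ (c + e) + (t + t)
c+t≤c+e+[t+t] c e t = +-mono-≤ (m≤m+n c e) (m≤n+m t t)

[c+t]+[c+t]≡c+c+[t+t] : ∀ c t → (c + t) + (c + t) ≡ (c + c) + (t + t)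
[c+t]+[c+t]≡c+c+[t+t] = solve-∀

j+t≤[c+t]+[c+t] : ∀ {j} c t → j ≤ c + c → j + t ≤ (c + t) + (c + t)
j+t≤[c+t]+[c+t] {j} c t j≤c+c =
  subst (j + t ≤_) (sym ([c+t]+[c+t]≡c+c+[t+t] c t)) (+-mono-≤ j≤c+c (m≤n+m t t))

double-window : ∀ t → suc ((8 + t) + (8 + t) + 1) ≡ 18 + (t + t)
double-window = solve-∀

largestPart≤maxLargest : ∀ {t μ} → InU (T (11 + t)) μ → largestPart μ ≤ maxLargest t
largestPart≤maxLargest {t} {μ} μ∈U = ≮⇒≥ λ M<L → <-irrefl refl (begin-strict
  T (11 + t)                                  ≡⟨ T-value t ⟩
  triangular (8 + t) + 6 + maxLargest t       ≡⟨ +-assoc (triangular (8 + t)) 6 _ ⟩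
  triangular (8 + t) + (6 + maxLargest t)     <⟨ +-monoʳ-< (triangular (8 + t)) (+-mono-≤-< (m≤m+n 6 (3 + t)) M<L) ⟩
  triangular (8 + t) + ((9 + t) + largestPart μ) ≡⟨ +-assoc (triangular (8 + t)) (9 + t) _ ⟨
  triangular (9 + t) + largestPart μ          ≤⟨ triangular+largestPart≤ (9 + t) μ∈U (subst (_< largestPart μ) (sym ([c+t]+[c+t]≡c+c+[t+t] 9 t)) M<L) ⟩
  T (11 + t)                                  ∎)
  where open ≤-Reasoning

record Extremal (t : ℕ) (μ : List ℕ) : Set where
  constructor extremal
  field
    inU          : InU (T (11 + t)) μ
    largestPart≡ : largestPart μ ≡ maxLargest t

PatternA PatternB : ℕ → List ℕ → Set
PatternA t μ = 6 + t ∈ μ × 7 + t ∉ μ × 8 + t ∉ μ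
PatternB t μ = 6 + t ∉ μ × 7 + t ∈ μ × 8 + t ∈ μ

module ExtremalStructure {t μ} (μ-ext : Extremal t μ) where

  open Extremal μ-ext

  private
    μ∈D : DistinctPartition (T (11 + t)) μ
    μ∈D = proj₁ inU
    unref : Unrefinable μ
    unref = proj₂ inU
    pw : ℕ → ℕ
    pw = pairWeight μ (maxLargest t)

  strictlyIncreasing : Linked _<_ μ
  strictlyIncreasing = proj₁ μ∈D

  positive : All (1 ≤_) μ
  positive = proj₁ (proj₂ μ∈D)

  M∈μ : maxLargest t ∈ μ
  M∈μ = subst (_∈ μ) largestPart≡ (largestPart-∈ μ∈D)

  parts≤M : All (_≤ maxLargest t) μ
  parts≤M = subst (λ L → All (_≤ L) μ) largestPart≡ (parts≤largestPart μ)

  ∑pairs+middle≡ : ∑ (8 + t) pw + weight μ (9 + t) ≡ triangular (8 + t) + 6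
  ∑pairs+middle≡ = +-cancelʳ-≡ (maxLargest t) _ _ (begin
    ∑ (8 + t) pw + weight μ (9 + t) + maxLargest t
      ≡⟨ cong (λ v → ∑ (8 + t) pw + weight μ v + maxLargest t) (+-comm (8 + t) 1) ⟨
    ∑ (8 + t) pw + ∑ 1 (λ i → weight μ (8 + t + i)) + maxLargest t
      ≡⟨ sum-paired (8 + t) 1 (distinct⇒unique μ∈D) positive parts≤M M∈μ (sym (double-window t)) ⟨
    sum μ
      ≡⟨ proj₂ (proj₂ (proj₂ μ∈D)) ⟩
    T (11 + t)
      ≡⟨ T-value t ⟩
    triangular (8 + t) + 6 + maxLargest t ∎)
    where open ≡-Reasoning

  pw-≥ : ∀ a → 1 ≤ a → a ≤ 8 + t → a ≤ pw a
  pw-≥ a 1≤a a≤k = pairWeight-≥ unref M∈μ 1≤a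
    (≤-trans (s≤s (+-mono-≤ a≤k a≤k)) (≤-trans (s≤s (m≤m+n _ 1)) (≤-reflexive (double-window t))))

  pw-≤ : ∀ a → 1 ≤ a → a ≤ 8 + t → pw a ≤ a + 6
  pw-≤ = ∑-slack (8 + t) 6 pw-≥ (≤-trans (m≤m+n _ _) (≤-reflexive ∑pairs+middle≡))

  middle∉ : 9 + t ∉ μ
  middle∉ 9+t∈μ = <⇒≱ (m≤m+n 7 (2 + t)) (begin
    9 + t              ≡⟨ weight-∈ {μ} 9+t∈μ ⟨
    weight μ (9 + t)   ≤⟨ +-cancelˡ-≤ (triangular (8 + t)) _ _ (begin
        triangular (8 + t) + weight μ (9 + t) ≤⟨ +-monoˡ-≤ _ (∑-mono-≤ (8 + t) pw-≥) ⟩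
        ∑ (8 + t) pw + weight μ (9 + t)       ≡⟨ ∑pairs+middle≡ ⟩
        triangular (8 + t) + 6                ∎) ⟩
    6                  ∎)
    where open ≤-Reasoning

  -- Both members of a pair would weigh a + (M − a) = M, more than the slack a + 6 allows.
  onlyOne : ∀ a → 1 ≤ a → a ≤ 8 + t → ∃ (OnlyOne μ a (maxLargest t ∸ a))
  onlyOne a 1≤a a≤k with a ∈? μ | (maxLargest t ∸ a) ∈? μ
  ... | yes a∈μ | no  b∉μ = a , only-left a∈μ b∉μ
  ... | no  a∉μ | yes b∈μ = _ , only-right a∉μ b∈μ
  ... | no  a∉μ | no  b∉μ = contradiction (≤-trans (pw-≥ a 1≤a a≤k) (≤-reflexive none)) (<⇒≱ 1≤a)
    where
    none : pw a ≡ 0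
    none = cong₂ _+_ (weight-∉ {μ} a∉μ) (weight-∉ {μ} b∉μ)
  ... | yes a∈μ | yes b∈μ = contradiction (pw-≤ a 1≤a a≤k) (<⇒≱ (begin-strict
    a + 6                       <⟨ +-monoʳ-< a (m≤m+n 7 (3 + t)) ⟩
    a + (10 + t)                ≡⟨ cong (a +_) (maxLargest-∸ 8 10 t) ⟨
    a + (maxLargest t ∸ (8 + t)) ≤⟨ +-monoʳ-≤ a (∸-monoʳ-≤ (maxLargest t) a≤k) ⟩
    a + (maxLargest t ∸ a)      ≡⟨ cong₂ _+_ (weight-∈ {μ} a∈μ) (weight-∈ {μ} b∈μ) ⟨
    pw a                        ∎))
    where open ≤-Reasoning

  initial : ∀ a → 1 ≤ a → a ≤ 5 + t → a ∈ μ × maxLargest t ∸ a ∉ μ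
  initial a 1≤a a≤5+t = lower-only (onlyOne a 1≤a a≤k)
    where
    a≤k : a ≤ 8 + t
    a≤k = ≤-trans a≤5+t (+-monoˡ-≤ t (m≤m+n 5 3))
    lower-only : ∃ (OnlyOne μ a (maxLargest t ∸ a)) → a ∈ μ × maxLargest t ∸ a ∉ μ
    lower-only (_ , only-left a∈μ b∉μ)  = a∈μ , b∉μ
    lower-only (_ , only-right a∉μ b∈μ) = contradiction (pw-≤ a 1≤a a≤k) (<⇒≱ (begin-strict
      a + 6                        ≤⟨ +-monoˡ-≤ 6 a≤5+t ⟩
      5 + t + 6                    ≡⟨ +-comm (5 + t) 6 ⟩
      11 + t                       <⟨ n≤1+n (12 + t) ⟩
      13 + t                       ≡⟨ maxLargest-∸ 5 13 t ⟨
      maxLargest t ∸ (5 + t)       ≤⟨ ∸-monoʳ-≤ (maxLargest t) a≤5+t ⟩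
      maxLargest t ∸ a             ≡⟨ onlyOne-weight (only-right a∉μ b∈μ) ⟨
      pw a                         ∎))
      where open ≤-Reasoning

  private
    pw-partner : ∀ {a b w} → maxLargest t ∸ a ≡ b → OnlyOne μ a b w → pw a ≡ w
    pw-partner refl = onlyOne-weight

    partner : ∀ {a b} → 1 ≤ a → a ≤ 8 + t → maxLargest t ∸ a ≡ b → ∃ (OnlyOne μ a b)
    partner 1≤a a≤k refl = onlyOne _ 1≤a a≤k

    window-sum : ∀ {w₆ w₇ w₈} → OnlyOne μ (6 + t) (12 + t) w₆ → OnlyOne μ (7 + t) (11 + t) w₇ →
                 OnlyOne μ (8 + t) (10 + t) w₈ →
                 triangular (5 + t) + w₆ + w₇ + w₈ ≡ triangular (5 + t) + (6 + t) + (7 + t) + (8 + t) + 6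
    window-sum {w₆} {w₇} {w₈} c₆ c₇ c₈ = begin
      triangular (5 + t) + w₆ + w₇ + w₈
        ≡⟨ cong (λ s → s + w₆ + w₇ + w₈) (∑-cong (5 + t) λ a 1≤a a≤5+t → onlyOne-weight (uncurry only-left (initial a 1≤a a≤5+t))) ⟨
      ∑ (5 + t) pw + w₆ + w₇ + w₈
        ≡⟨ cong₂ _+_ (cong₂ _+_ (cong (∑ (5 + t) pw +_) (pw-partner (maxLargest-∸ 6 12 t) c₆))
                                (pw-partner (maxLargest-∸ 7 11 t) c₇))
                     (pw-partner (maxLargest-∸ 8 10 t) c₈) ⟨
      ∑ (8 + t) pw
        ≡⟨ +-identityʳ _ ⟨
      ∑ (8 + t) pw + 0
        ≡⟨ cong (∑ (8 + t) pw +_) (weight-∉ {μ} middle∉) ⟨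
      ∑ (8 + t) pw + weight μ (9 + t)
        ≡⟨ ∑pairs+middle≡ ⟩
      triangular (8 + t) + 6 ∎
      where open ≡-Reasoning

    offsets : ∀ d₆ d₇ d₈ →
              triangular (5 + t) + (d₆ + (6 + t)) + (d₇ + (7 + t)) + (d₈ + (8 + t)) ≡
              triangular (5 + t) + (6 + t) + (7 + t) + (8 + t) + 6 → d₆ + d₇ + d₈ ≡ 6
    offsets d₆ d₇ d₈ e = +-cancelʳ-≡ X _ _
      (trans (sym (collect (triangular (5 + t)) (6 + t) (7 + t) (8 + t) d₆ d₇ d₈))
             (trans e (+-comm X 6)))
      where
      X = triangular (5 + t) + (6 + t) + (7 + t) + (8 + t)
      collect : ∀ X a₆ a₇ a₈ d₆ d₇ d₈ →
                X + (d₆ + a₆) + (d₇ + a₇) + (d₈ + a₈) ≡ (d₆ + d₇ + d₈) + (X + a₆ + a₇ + a₈)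
      collect = solve-∀

    decide : ∀ {w₆ w₇ w₈} → OnlyOne μ (6 + t) (12 + t) w₆ → OnlyOne μ (7 + t) (11 + t) w₇ →
             OnlyOne μ (8 + t) (10 + t) w₈ →
             triangular (5 + t) + w₆ + w₇ + w₈ ≡ triangular (5 + t) + (6 + t) + (7 + t) + (8 + t) + 6 →
             PatternA t μ ⊎ PatternB t μ
    decide (only-left i₆ _)  (only-right o₇ _) (only-right o₈ _) _ = inj₁ (i₆ , o₇ , o₈)
    decide (only-right o₆ _) (only-left i₇ _)  (only-left i₈ _)  _ = inj₂ (o₆ , i₇ , i₈)
    decide (only-left _ _)   (only-left _ _)   (only-left _ _)   e = contradiction (offsets 0 0 0 e) λ ()
    decide (only-left _ _)   (only-left _ _)   (only-right _ _)  e = contradiction (offsets 0 0 2 e) λ ()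
    decide (only-left _ _)   (only-right _ _)  (only-left _ _)   e = contradiction (offsets 0 4 0 e) λ ()
    decide (only-right _ _)  (only-left _ _)   (only-right _ _)  e = contradiction (offsets 6 0 2 e) λ ()
    decide (only-right _ _)  (only-right _ _)  (only-left _ _)   e = contradiction (offsets 6 4 0 e) λ ()
    decide (only-right _ _)  (only-right _ _)  (only-right _ _)  e = contradiction (offsets 6 4 2 e) λ ()

  window-pattern : PatternA t μ ⊎ PatternB t μ
  window-pattern = by-choices (partner (s≤s z≤n) (+-monoˡ-≤ t (m≤m+n 6 2)) (maxLargest-∸ 6 12 t))
                              (partner (s≤s z≤n) (+-monoˡ-≤ t (m≤m+n 7 1)) (maxLargest-∸ 7 11 t))
                              (partner (s≤s z≤n) ≤-refl (maxLargest-∸ 8 10 t))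
    where
    by-choices : ∃ (OnlyOne μ (6 + t) (12 + t)) → ∃ (OnlyOne μ (7 + t) (11 + t)) →
                 ∃ (OnlyOne μ (8 + t) (10 + t)) → PatternA t μ ⊎ PatternB t μ
    by-choices (_ , c₆) (_ , c₇) (_ , c₈) = decide c₆ c₇ c₈ (window-sum c₆ c₇ c₈)

position : ∀ {t v} → v ≤ maxLargest t →
           v ≤ 8 + t ⊎ v ≡ 9 + t ⊎ (9 + t < v × v < maxLargest t) ⊎ v ≡ maxLargest t
position {t} {v} v≤M with v ≤? 8 + t | 9 + t ≟ v | v ≟ maxLargest t
... | yes v≤k | _          | _       = inj₁ v≤k
... | no  _   | yes 9+t≡v  | _       = inj₂ (inj₁ (sym 9+t≡v))
... | no  _   | no  _      | yes v≡M = inj₂ (inj₂ (inj₂ v≡M))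
... | no  v≰k | no  9+t≢v  | no  v≢M = inj₂ (inj₂ (inj₁ (≤∧≢⇒< (≰⇒> v≰k) 9+t≢v , ≤∧≢⇒< v≤M v≢M)))

LowerAgreement : ℕ → List ℕ → List ℕ → Set
LowerAgreement t μ ν = ∀ a → 1 ≤ a → a ≤ 8 + t → a ∈ μ ⇔ a ∈ ν

module _ {t μ ν} (μ-ext : Extremal t μ) (ν-ext : Extremal t ν) (agree : LowerAgreement t μ ν) where

  private
    module Mμ = ExtremalStructure μ-ext
    module Mν = ExtremalStructure ν-ext

  complement-transfer : ∀ {a b} → 1 ≤ a → a ≤ 8 + t → maxLargest t ∸ a ≡ b → b ∈ μ → b ∈ ν
  complement-transfer 1≤a a≤k refl b∈μ with Mμ.onlyOne _ 1≤a a≤k | Mν.onlyOne _ 1≤a a≤k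
  ... | _ , only-left _ b∉μ  | _                  = contradiction b∈μ b∉μ
  ... | _ , only-right a∉μ _ | _ , only-left a∈ν _ = contradiction (Equivalence.from (agree _ 1≤a a≤k) a∈ν) a∉μ
  ... | _ , only-right _ _   | _ , only-right _ b∈ν = b∈ν

  extremal-⊆ : ∀ {v} → v ∈ μ → v ∈ ν
  extremal-⊆ {v} v∈μ with position {t} (All.lookup Mμ.parts≤M v∈μ)
  ... | inj₁ v≤k                = Equivalence.to (agree v (All.lookup Mμ.positive v∈μ) v≤k) v∈μ
  ... | inj₂ (inj₁ refl)        = contradiction v∈μ Mμ.middle∉
  ... | inj₂ (inj₂ (inj₂ refl)) = Mν.M∈μ
  ... | inj₂ (inj₂ (inj₁ (9+t<v , v<M))) =
    complement-transfer (m<n⇒0<n∸m v<M)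
      (≤-trans (∸-monoʳ-≤ (maxLargest t) 9+t<v) (≤-reflexive (maxLargest-∸ 10 8 t)))
      (m∸[m∸n]≡n (<⇒≤ v<M)) v∈μ

extremal-≡ : ∀ {t μ ν} → Extremal t μ → Extremal t ν → LowerAgreement t μ ν → μ ≡ ν
extremal-≡ μ-ext ν-ext agree =
  strictlySorted-≡ (ExtremalStructure.strictlyIncreasing μ-ext) (ExtremalStructure.strictlyIncreasing ν-ext)
    (mk⇔ (extremal-⊆ μ-ext ν-ext agree)
         (extremal-⊆ ν-ext μ-ext λ a 1≤a a≤k → ⇔-sym (agree a 1≤a a≤k)))

both-in : ∀ {a : ℕ} {μ ν} → a ∈ μ → a ∈ ν → a ∈ μ ⇔ a ∈ ν
both-in a∈μ a∈ν = mk⇔ (λ _ → a∈ν) (λ _ → a∈μ)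

both-out : ∀ {a : ℕ} {μ ν} → a ∉ μ → a ∉ ν → a ∈ μ ⇔ a ∈ ν
both-out a∉μ a∉ν = mk⇔ (λ a∈μ → contradiction a∈μ a∉μ) (λ a∈ν → contradiction a∈ν a∉ν)

pattern-agreement : ∀ {t μ ν} → Extremal t μ → Extremal t ν →
                    (PatternA t μ × PatternA t ν) ⊎ (PatternB t μ × PatternB t ν) → LowerAgreement t μ ν
pattern-agreement {t} μ-ext ν-ext same a 1≤a a≤k with a ≤? 5 + t
... | yes a≤5+t = both-in (proj₁ (ExtremalStructure.initial μ-ext a 1≤a a≤5+t))
                          (proj₁ (ExtremalStructure.initial ν-ext a 1≤a a≤5+t))
... | no  a≰5+t with between (≰⇒> a≰5+t) a≤k | same
...   | inj₁ refl        | inj₁ ((i , _ , _) , (i′ , _ , _)) = both-in i i′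
...   | inj₁ refl        | inj₂ ((o , _ , _) , (o′ , _ , _)) = both-out o o′
...   | inj₂ (inj₁ refl) | inj₁ ((_ , o , _) , (_ , o′ , _)) = both-out o o′
...   | inj₂ (inj₁ refl) | inj₂ ((_ , i , _) , (_ , i′ , _)) = both-in i i′
...   | inj₂ (inj₂ refl) | inj₁ ((_ , _ , o) , (_ , _ , o′)) = both-out o o′
...   | inj₂ (inj₂ refl) | inj₂ ((_ , _ , i) , (_ , _ , i′)) = both-in i i′

maxLargest-summands : ∀ {t a b} → a + b ≡ maxLargest t → a < b → a ≤ 8 + t × b ≡ maxLargest t ∸ a
maxLargest-summands {t} {a} {b} a+b≡M a<b =
  ≮⇒≥ (λ 8+t<a → <-irrefl refl (begin-strict
    maxLargest t      ≡⟨ [c+t]+[c+t]≡c+c+[t+t] 9 t ⟨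
    (9 + t) + (9 + t) ≤⟨ +-mono-≤ 8+t<a 8+t<a ⟩
    a + a             <⟨ +-monoʳ-< a a<b ⟩
    a + b             ≡⟨ a+b≡M ⟩
    maxLargest t      ∎))
  , sym (trans (cong (_∸ a) (sym a+b≡M)) (m+n∸m≡n a b))
  where open ≤-Reasoning

small-part-not-summed : ∀ {m a b p} → m < a → a < b → a + b ≡ p → p ≤ suc m + suc m → ⊥
small-part-not-summed m<a a<b refl = <⇒≱ (+-mono-≤-< m<a (≤-<-trans m<a a<b))

oneTo++-largestPart : ∀ {m p tl} → p ∈ tl → All (_≤ p) tl → m ≤ p → largestPart (oneTo m ++ tl) ≡ p
oneTo++-largestPart {m} p∈tl tl≤p m≤p =
  largestPart-≡ (∈-++⁺ʳ (oneTo m) p∈tl) (All.++⁺ (All.tabulate λ v∈ → ≤-trans (proj₂ (∈-oneTo⁻ v∈)) m≤p) tl≤p)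

partitionA partitionB : ℕ → List ℕ
partitionA t = oneTo (6 + t) ++ 10 + t ∷ 11 + t ∷ maxLargest t ∷ []
partitionB t = oneTo (5 + t) ++ 7 + t ∷ 8 + t ∷ 12 + t ∷ maxLargest t ∷ []

maxLargest-summands≥6+t : ∀ {t a b} → a + b ≡ maxLargest t → a < b → 6 + t ≤ a →
                          (a ≡ 6 + t × b ≡ 12 + t) ⊎ (a ≡ 7 + t × b ≡ 11 + t) ⊎ (a ≡ 8 + t × b ≡ 10 + t)
maxLargest-summands≥6+t {t} {a} {b} a+b≡M a<b 6+t≤a = by-position (between 6+t≤a a≤k)
  where
  a≤k : a ≤ 8 + t
  a≤k = proj₁ (maxLargest-summands {t} a+b≡M a<b)
  b≡M∸a : b ≡ maxLargest t ∸ a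
  b≡M∸a = proj₂ (maxLargest-summands {t} a+b≡M a<b)
  partner : ∀ {c d} → a ≡ c → maxLargest t ∸ c ≡ d → b ≡ d
  partner a≡c M∸c≡d = trans b≡M∸a (trans (cong (maxLargest t ∸_) a≡c) M∸c≡d)
  by-position : a ≡ 6 + t ⊎ a ≡ 7 + t ⊎ a ≡ 8 + t →
                (a ≡ 6 + t × b ≡ 12 + t) ⊎ (a ≡ 7 + t × b ≡ 11 + t) ⊎ (a ≡ 8 + t × b ≡ 10 + t)
  by-position (inj₁ a≡)        = inj₁ (a≡ , partner a≡ (maxLargest-∸ 6 12 t))
  by-position (inj₂ (inj₁ a≡)) = inj₂ (inj₁ (a≡ , partner a≡ (maxLargest-∸ 7 11 t)))
  by-position (inj₂ (inj₂ a≡)) = inj₂ (inj₂ (a≡ , partner a≡ (maxLargest-∸ 8 10 t)))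

partitionA-unrefinable : ∀ t → Unrefinable (partitionA t)
partitionA-unrefinable t = unrefinable-criterion (6 + t) (λ 1≤a a≤m → ∈-++⁺ˡ (∈-oneTo⁺ 1≤a a≤m)) large
  where
  large : ∀ {a b} → 6 + t < a → a < b → a + b ∈ partitionA t → a ∈ partitionA t ⊎ b ∈ partitionA t
  large {a} {b} m<a a<b a+b∈ = by-part (∈-++⁻ (oneTo (6 + t)) a+b∈)
    where
    by-top : (a ≡ 6 + t × b ≡ 12 + t) ⊎ (a ≡ 7 + t × b ≡ 11 + t) ⊎ (a ≡ 8 + t × b ≡ 10 + t) →
             a ∈ partitionA t ⊎ b ∈ partitionA t
    by-top (inj₁ (a≡ , _))        = contradiction (subst (6 + t <_) a≡ m<a) (<-irrefl refl)
    by-top (inj₂ (inj₁ (_ , b≡))) = inj₂ (subst (_∈ partitionA t) (sym b≡) (∈-++⁺ʳ (oneTo (6 + t)) (there (here refl))))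
    by-top (inj₂ (inj₂ (_ , b≡))) = inj₂ (subst (_∈ partitionA t) (sym b≡) (∈-++⁺ʳ (oneTo (6 + t)) (here refl)))
    by-part : a + b ∈ oneTo (6 + t) ⊎ a + b ∈ 10 + t ∷ 11 + t ∷ maxLargest t ∷ [] →
              a ∈ partitionA t ⊎ b ∈ partitionA t
    by-part (inj₁ a+b∈oneTo) = contradiction (proj₂ (∈-oneTo⁻ a+b∈oneTo)) (<⇒≱ (≤-trans m<a (m≤m+n a b)))
    by-part (inj₂ (here e)) = ⊥-elim (small-part-not-summed m<a a<b e (j+t≤[c+t]+[c+t] 7 t (m≤m+n 10 4)))
    by-part (inj₂ (there (here e))) = ⊥-elim (small-part-not-summed m<a a<b e (j+t≤[c+t]+[c+t] 7 t (m≤m+n 11 3)))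
    by-part (inj₂ (there (there (here e)))) = by-top (maxLargest-summands≥6+t {t} e a<b (<⇒≤ m<a))

partitionB-unrefinable : ∀ t → Unrefinable (partitionB t)
partitionB-unrefinable t = unrefinable-criterion (5 + t) (λ 1≤a a≤m → ∈-++⁺ˡ (∈-oneTo⁺ 1≤a a≤m)) large
  where
  large : ∀ {a b} → 5 + t < a → a < b → a + b ∈ partitionB t → a ∈ partitionB t ⊎ b ∈ partitionB t
  large {a} {b} m<a a<b a+b∈ = by-part (∈-++⁻ (oneTo (5 + t)) a+b∈)
    where
    by-top : (a ≡ 6 + t × b ≡ 12 + t) ⊎ (a ≡ 7 + t × b ≡ 11 + t) ⊎ (a ≡ 8 + t × b ≡ 10 + t) →
             a ∈ partitionB t ⊎ b ∈ partitionB t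
    by-top (inj₁ (_ , b≡))        = inj₂ (subst (_∈ partitionB t) (sym b≡) (∈-++⁺ʳ (oneTo (5 + t)) (there (there (here refl)))))
    by-top (inj₂ (inj₁ (a≡ , _))) = inj₁ (subst (_∈ partitionB t) (sym a≡) (∈-++⁺ʳ (oneTo (5 + t)) (here refl)))
    by-top (inj₂ (inj₂ (a≡ , _))) = inj₁ (subst (_∈ partitionB t) (sym a≡) (∈-++⁺ʳ (oneTo (5 + t)) (there (here refl))))
    by-part : a + b ∈ oneTo (5 + t) ⊎ a + b ∈ 7 + t ∷ 8 + t ∷ 12 + t ∷ maxLargest t ∷ [] →
              a ∈ partitionB t ⊎ b ∈ partitionB t
    by-part (inj₁ a+b∈oneTo) = contradiction (proj₂ (∈-oneTo⁻ a+b∈oneTo)) (<⇒≱ (≤-trans m<a (m≤m+n a b)))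
    by-part (inj₂ (here e)) = ⊥-elim (small-part-not-summed m<a a<b e (j+t≤[c+t]+[c+t] 6 t (m≤m+n 7 5)))
    by-part (inj₂ (there (here e))) = ⊥-elim (small-part-not-summed m<a a<b e (j+t≤[c+t]+[c+t] 6 t (m≤m+n 8 4)))
    by-part (inj₂ (there (there (here e)))) = ⊥-elim (small-part-not-summed m<a a<b e (j+t≤[c+t]+[c+t] 6 t ≤-refl))
    by-part (inj₂ (there (there (there (here e))))) = by-top (maxLargest-summands≥6+t {t} e a<b m<a)

partitionA-extremal : ∀ t → Extremal t (partitionA t)
partitionA-extremal t = extremal
    ( subst (λ N → DistinctPartition N (partitionA t)) (sym (trans (T-value t) (regroup (triangular (6 + t)) t)))
        (oneTo++-distinct tail↗ (+-monoˡ-≤ t (m≤m+n 7 3) ∷ +-monoˡ-≤ t (m≤m+n 7 4) ∷ c+t≤c+e+[t+t] 7 11 t ∷ [])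
                          (s≤s (s≤s z≤n)))
    , partitionA-unrefinable t )
    (oneTo++-largestPart (there (there (here refl))) (<⇒≤ 10<M ∷ <⇒≤ 11<M ∷ ≤-refl ∷ []) (c+t≤c+e+[t+t] 6 12 t))
  where
  10<M : 10 + t < maxLargest t
  10<M = c+t≤c+e+[t+t] 11 7 t
  11<M : 11 + t < maxLargest t
  11<M = c+t≤c+e+[t+t] 12 6 t
  tail↗ : AllPairs _<_ (10 + t ∷ 11 + t ∷ maxLargest t ∷ [])
  tail↗ = (≤-refl ∷ 10<M ∷ []) ∷ (11<M ∷ []) ∷ [] ∷ []
  regroup : ∀ X t → X + (7 + t) + (8 + t) + 6 + (18 + (t + t)) ≡ X + ((10 + t) + ((11 + t) + ((18 + (t + t)) + 0)))
  regroup = solve-∀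

partitionB-extremal : ∀ t → Extremal t (partitionB t)
partitionB-extremal t = extremal
    ( subst (λ N → DistinctPartition N (partitionB t)) (sym (trans (T-value t) (regroup (triangular (5 + t)) t)))
        (oneTo++-distinct tail↗ (+-monoˡ-≤ t (m≤m+n 6 1) ∷ +-monoˡ-≤ t (m≤m+n 6 2) ∷ +-monoˡ-≤ t (m≤m+n 6 6)
                                 ∷ c+t≤c+e+[t+t] 6 12 t ∷ [])
                          (s≤s (s≤s z≤n)))
    , partitionB-unrefinable t )
    (oneTo++-largestPart (there (there (there (here refl))))
      (<⇒≤ 7<M ∷ <⇒≤ 8<M ∷ <⇒≤ 12<M ∷ ≤-refl ∷ []) (c+t≤c+e+[t+t] 5 13 t))
  where
  7<M : 7 + t < maxLargest t
  7<M = c+t≤c+e+[t+t] 8 10 t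
  8<M : 8 + t < maxLargest t
  8<M = c+t≤c+e+[t+t] 9 9 t
  12<M : 12 + t < maxLargest t
  12<M = c+t≤c+e+[t+t] 13 5 t
  tail↗ : AllPairs _<_ (7 + t ∷ 8 + t ∷ 12 + t ∷ maxLargest t ∷ [])
  tail↗ = (≤-refl ∷ +-monoˡ-≤ t (m≤m+n 8 4) ∷ 7<M ∷ []) ∷ (+-monoˡ-≤ t (m≤m+n 9 3) ∷ 8<M ∷ []) ∷ (12<M ∷ []) ∷ [] ∷ []
  regroup : ∀ X t → X + (6 + t) + (7 + t) + (8 + t) + 6 + (18 + (t + t))
                  ≡ X + ((7 + t) + ((8 + t) + ((12 + t) + ((18 + (t + t)) + 0))))
  regroup = solve-∀

partitionA-pattern : ∀ t → PatternA t (partitionA t)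
partitionA-pattern t = [ id , (λ p₂ → contradiction 6+t∈ (proj₁ p₂)) ]′
                         (ExtremalStructure.window-pattern (partitionA-extremal t))
  where
  6+t∈ : 6 + t ∈ partitionA t
  6+t∈ = ∈-++⁺ˡ (∈-oneTo⁺ (s≤s z≤n) ≤-refl)

partitionB-pattern : ∀ t → PatternB t (partitionB t)
partitionB-pattern t = [ (λ p₁ → contradiction 7+t∈ (proj₁ (proj₂ p₁))) , id ]′
                         (ExtremalStructure.window-pattern (partitionB-extremal t))
  where
  7+t∈ : 7 + t ∈ partitionB t
  7+t∈ = ∈-++⁺ʳ (oneTo (5 + t)) (here refl)

partitionA≢partitionB : ∀ t → partitionA t ≢ partitionB t
partitionA≢partitionB t A≡B = proj₁ (partitionB-pattern t) (subst (6 + t ∈_) A≡B (proj₁ (partitionA-pattern t)))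

extremal-classification : ∀ {t μ} → Extremal t μ → μ ≡ partitionA t ⊎ μ ≡ partitionB t
extremal-classification {t} μ-ext =
  [ (λ μ₁ → inj₁ (extremal-≡ μ-ext A-ext (pattern-agreement μ-ext A-ext (inj₁ (μ₁ , partitionA-pattern t)))))
  , (λ μ₂ → inj₂ (extremal-≡ μ-ext B-ext (pattern-agreement μ-ext B-ext (inj₂ (μ₂ , partitionB-pattern t)))))
  ]′ (ExtremalStructure.window-pattern μ-ext)
  where
  A-ext : Extremal t (partitionA t)
  A-ext = partitionA-extremal t
  B-ext : Extremal t (partitionB t)
  B-ext = partitionB-extremal t

extremal⇒InUStar : ∀ {t μ} → Extremal t μ → InUStar (T (11 + t)) μ
extremal⇒InUStar {t} (extremal μ∈U L≡M) =
  μ∈U , λ ν ν∈U → subst (largestPart ν ≤_) (sym L≡M) (largestPart≤maxLargest {t} ν∈U)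

InUStar⇒extremal : ∀ {t μ} → InUStar (T (11 + t)) μ → Extremal t μ
InUStar⇒extremal {t} (μ∈U , maximal) =
  extremal μ∈U (≤-antisym (largestPart≤maxLargest {t} μ∈U)
                          (subst (_≤ _) (Extremal.largestPart≡ A-ext) (maximal (partitionA t) (Extremal.inU A-ext))))
  where
  A-ext : Extremal t (partitionA t)
  A-ext = partitionA-extremal t

ExactlyTwo : (List ℕ → Set) → Set
ExactlyTwo P = ∃₂ λ (λ₁ λ₂ : List ℕ) → λ₁ ≢ λ₂ × P λ₁ × P λ₂ × (∀ μ → P μ → μ ≡ λ₁ ⊎ μ ≡ λ₂)

exactlyTwo-𝕌* : ∀ t → ExactlyTwo (InUStar (T (11 + t)))
exactlyTwo-𝕌* t =
    partitionA t , partitionB t , partitionA≢partitionB t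
  , extremal⇒InUStar (partitionA-extremal t) , extremal⇒InUStar (partitionB-extremal t)
  , λ μ μ∈U* → extremal-classification (InUStar⇒extremal {t} μ∈U*)

corollary3p3 : ∀ (n : ℕ) → 11 ≤ n →
    ∃₂ λ (λ₁ λ₂ : List ℕ) → λ₁ ≢ λ₂ × InUStar (T n) λ₁ × InUStar (T n) λ₂ ×
      (∀ μ → InUStar (T n) μ → μ ≡ λ₁ ⊎ μ ≡ λ₂)
corollary3p3 n 11≤n = from-offset (proj₂ (m≤n⇒∃[o]m+o≡n 11≤n))
  where
  from-offset : ∀ {t} → 11 + t ≡ n → ExactlyTwo (InUStar (T n))
  from-offset {t} refl = exactlyTwo-𝕌* t
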